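{- Let $k$ be a field of characteristic $p>2$ and $g\geq 2$. Then $$\mathrm{Det}_g(\lambda_1,\ldots,\lambda_{2g-1},0,0) = (-\lambda_1\cdots\lambda_{2g-1})^{(p-1)/2}\,\mathrm{Det}_{g-1}(\lambda_1,\ldots,\lambda_{2g-1}).$$
   Context: For $h\geq 1$, let $c_r\in k[\lambda_1,\dots,\lambda_{2h+1}]$ be the coefficient of $x^r$ in $\left(\prod_{i=1}^{2h+1}(x-\lambda_i)\right)^{(p-1)/2}$ (with $c_r=0$ for $r<0$), $A_h$ the $h\times h$ matrix with $(i,j)$ entry $c_{ip-j}$, and $\mathrm{Det}_h(\lambda_1,\dots,\lambda_{2h+1}) = \det A_h$. -}

module Defs where

open import Level using (_⊔_)
open import Algebra.Bundles using (CommutativeRing)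
open import Data.Nat using (ℕ; zero; suc; _∸_; _≤ᵇ_; ⌊_/2⌋) renaming (_*_ to _*ℕ_; _+_ to _+ℕ_)
open import Data.Fin using (Fin; zero; suc; toℕ; punchIn)
open import Data.List using (List; []; _∷_; map)
open import Data.Bool using (if_then_else_)
open import Data.Product using (∃)
open import Relation.Nullary using (¬_)

record IsField {c ℓ} (K : CommutativeRing c ℓ) : Set (c ⊔ ℓ) where
  open CommutativeRing K
  field
    1≉0     : ¬ (1# ≈ 0#)
    inverse : ∀ x → ¬ (x ≈ 0#) → ∃ λ y → x * y ≈ 1#

module _ {c ℓ} (R : CommutativeRing c ℓ) where
  open CommutativeRing R hiding (zero)

  ofℕ : ℕ → Carrier
  ofℕ zero    = 0#
  ofℕ (suc n) = 1# + ofℕ n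

  pow : Carrier → ℕ → Carrier
  pow x zero    = 1#
  pow x (suc n) = x * pow x n

  prodL : List Carrier → Carrier
  prodL []       = 1#
  prodL (a ∷ as) = a * prodL as

  -- univariate polynomials over R as coefficient lists, lowest degree first
  Poly : Set c
  Poly = List Carrier

  _⊕_ : Poly → Poly → Poly
  []      ⊕ q       = q
  (a ∷ p) ⊕ []      = a ∷ p
  (a ∷ p) ⊕ (b ∷ q) = (a + b) ∷ (p ⊕ q)

  _⊗_ : Poly → Poly → Poly
  []      ⊗ q = []
  (a ∷ p) ⊗ q = map (a *_) q ⊕ (0# ∷ (p ⊗ q))

  polyPow : Poly → ℕ → Poly
  polyPow f zero    = 1# ∷ []
  polyPow f (suc n) = f ⊗ polyPow f n

  prodLin : List Carrier → Poly
  prodLin []       = 1# ∷ []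
  prodLin (a ∷ as) = ((- a) ∷ 1# ∷ []) ⊗ prodLin as

  coeff : Poly → ℕ → Carrier
  coeff []      _       = 0#
  coeff (a ∷ f) zero    = a
  coeff (a ∷ f) (suc r) = coeff f r

  -- c_{m - j}: coefficient of x^(m-j) in (∏ (x - λ_i))^((p-1)/2), and 0 if m - j < 0
  cCoeff : (p : ℕ) → List Carrier → ℕ → ℕ → Carrier
  cCoeff p λs m j =
    if j ≤ᵇ m then coeff (polyPow (prodLin λs) ⌊ p ∸ 1 /2⌋) (m ∸ j) else 0#

  sumFin : (n : ℕ) → (Fin n → Carrier) → Carrier
  sumFin zero    f = 0#
  sumFin (suc n) f = f zero + sumFin n (λ i → f (suc i))

  det : (n : ℕ) → (Fin n → Fin n → Carrier) → Carrier
  det zero    M = 1#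
  det (suc n) M =
    sumFin (suc n) λ j → pow (- 1#) (toℕ j) * (M zero j * det n (λ a b → M (suc a) (punchIn j b)))

  -- A_h: (i,j) entry c_{ip - j}, 1 ≤ i, j ≤ h
  matA : (p h : ℕ) → List Carrier → Fin h → Fin h → Carrier
  matA p h λs i j = cCoeff p λs (suc (toℕ i) *ℕ p) (suc (toℕ j))

  Det : (p h : ℕ) → List Carrier → Carrier
  Det p h λs = det h (matA p h λs)

{-# OPTIONS --safe #-}
-- Appending two zero roots multiplies f = ∏ (x - λᵢ) by x², hence f^((p-1)/2) by x^(p-1)
-- since p is odd: the coefficient c′_r of the new power is c_(r-(p-1)), so that
-- c′_(ip-j) = c_((i-1)p-(j-1)). The first row of A_g is therefore (c₀, 0, …, 0), the
-- complementary minor is A_(g-1), and c₀ = f(0)^((p-1)/2) = (-λ₁⋯λ_(2g-1))^((p-1)/2).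
module Submission where

open import Defs using (IsField; ofℕ; pow; prodL; Det)
import Defs
open import Algebra.Bundles using (CommutativeRing)
open import Algebra.Morphism.Structures using (module RingMorphisms)
open import Data.Nat using (ℕ; _<_; _≤_; _∸_; _*_; ⌊_/2⌋)
open import Data.Nat.Primality using (Prime)
open import Data.Vec using (Vec; toList)
open import Data.List using (_++_; _∷_; [])

import Algebra.Properties.Ring as RingProperties
open import Data.Bool using (true; false; if_then_else_)
open import Data.Fin using (Fin; toℕ)
import Data.Fin as Fin
open import Data.List using (List; map; length; replicate)
open import Data.Nat as ℕ using (zero; suc; _≤ᵇ_; _≤?_)
open import Data.Nat.Divisibility using (_∣_; divides)
open import Data.Nat.Primality using (composite-≢; prime⇒¬composite)
open import Data.Nat.Properties
  using ( ≤ᵇ-reflects-≤; <⇒≱; <⇒≢; ≰⇒>; ≤-trans; m≤n+m; +-∸-assoc; m+n∸n≡m; ∸-monoʳ-<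
        ; +-suc; *-comm; suc-injective)
open import Data.Sum as Sum using (_⊎_; inj₁; inj₂)
open import Data.Vec.Properties using (length-toList)
open import Function using (_∘_)
open import Relation.Binary.Bundles using (Setoid)
open import Relation.Binary.Structures using (IsEquivalence)
open import Relation.Binary.PropositionalEquality using (_≡_; cong; subst)
import Relation.Binary.PropositionalEquality as ≡
import Relation.Binary.Reasoning.Setoid as SetoidReasoning
open import Relation.Nullary using (yes; no; contradiction)
open import Relation.Nullary.Reflects using (ofʸ; ofⁿ)

module _ {c ℓ} (R : CommutativeRing c ℓ) where
  open CommutativeRing R hiding (zero) renaming (_*_ to _·_)
  open RingProperties ring using (-0#≈0#; -‿distribˡ-*; -‿distribʳ-*; -‿involutive)
  module ≈-Reasoning = SetoidReasoning setoid

  private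
    Poly : Set c
    Poly = Defs.Poly R

    _⊕_ _⊗_ : Poly → Poly → Poly
    _⊕_ = Defs._⊕_ R
    _⊗_ = Defs._⊗_ R

    polyPow : Poly → ℕ → Poly
    polyPow = Defs.polyPow R

    prodLin : List Carrier → Poly
    prodLin = Defs.prodLin R

    coeff : Poly → ℕ → Carrier
    coeff = Defs.coeff R

    sumFin : (n : ℕ) → (Fin n → Carrier) → Carrier
    sumFin = Defs.sumFin R

    det : (n : ℕ) → (Fin n → Fin n → Carrier) → Carrier
    det = Defs.det R

  infixr 7 _⊗_
  infix 4 _≋_

  convolve : (ℕ → Carrier) → (ℕ → Carrier) → ℕ → Carrier
  convolve a b zero    = a 0 · b 0
  convolve a b (suc r) = a 0 · b (suc r) + convolve (a ∘ suc) b r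

  convolve-cong : ∀ {a a′ b b′} → (∀ i → a i ≈ a′ i) → (∀ i → b i ≈ b′ i) →
                  ∀ r → convolve a b r ≈ convolve a′ b′ r
  convolve-cong a≈a′ b≈b′ zero    = *-cong (a≈a′ 0) (b≈b′ 0)
  convolve-cong a≈a′ b≈b′ (suc r) =
    +-cong (*-cong (a≈a′ 0) (b≈b′ (suc r))) (convolve-cong (a≈a′ ∘ suc) b≈b′ r)

  convolve-zeroˡ : ∀ {a} b → (∀ i → a i ≈ 0#) → ∀ r → convolve a b r ≈ 0#
  convolve-zeroˡ b a≈0 zero    = trans (*-congʳ (a≈0 0)) (zeroˡ _)
  convolve-zeroˡ b a≈0 (suc r) =
    trans (+-cong (trans (*-congʳ (a≈0 0)) (zeroˡ _)) (convolve-zeroˡ b (a≈0 ∘ suc) r))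
          (+-identityˡ 0#)

  convolve-0∷ʳ : ∀ a B r → convolve a (coeff (0# ∷ B)) (suc r) ≈ convolve a (coeff B) r
  convolve-0∷ʳ a B zero    = trans (+-congˡ (zeroʳ _)) (+-identityʳ _)
  convolve-0∷ʳ a B (suc r) = +-congˡ (convolve-0∷ʳ (a ∘ suc) B r)

  coeff-⊕ : ∀ A B r → coeff (A ⊕ B) r ≈ coeff A r + coeff B r
  coeff-⊕ []      B       r       = sym (+-identityˡ _)
  coeff-⊕ (a ∷ A) []      r       = sym (+-identityʳ _)
  coeff-⊕ (a ∷ A) (b ∷ B) zero    = refl
  coeff-⊕ (a ∷ A) (b ∷ B) (suc r) = coeff-⊕ A B r

  coeff-map-· : ∀ a B r → coeff (map (a ·_) B) r ≈ a · coeff B r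
  coeff-map-· a []      r       = sym (zeroʳ a)
  coeff-map-· a (b ∷ B) zero    = refl
  coeff-map-· a (b ∷ B) (suc r) = coeff-map-· a B r

  coeff-⊗ : ∀ A B r → coeff (A ⊗ B) r ≈ convolve (coeff A) (coeff B) r
  coeff-⊗ []      B r       = sym (convolve-zeroˡ (coeff B) (λ _ → refl) r)
  coeff-⊗ (a ∷ A) B zero    =
    trans (coeff-⊕ (map (a ·_) B) _ 0) (trans (+-identityʳ _) (coeff-map-· a B 0))
  coeff-⊗ (a ∷ A) B (suc r) =
    trans (coeff-⊕ (map (a ·_) B) _ (suc r)) (+-cong (coeff-map-· a B (suc r)) (coeff-⊗ A B r))

  -- Coefficient lists that differ only by trailing zeros denote the same polynomial.
  record _≋_ (A B : Poly) : Set ℓ where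
    constructor coeffwise
    field coeff-≈ : ∀ r → coeff A r ≈ coeff B r
  open _≋_

  ≋-isEquivalence : IsEquivalence _≋_
  ≋-isEquivalence = record
    { refl  = coeffwise λ _ → refl
    ; sym   = λ A≋B → coeffwise (sym ∘ coeff-≈ A≋B)
    ; trans = λ A≋B B≋C → coeffwise λ r → trans (coeff-≈ A≋B r) (coeff-≈ B≋C r)
    }

  ≋-setoid : Setoid c ℓ
  ≋-setoid = record { isEquivalence = ≋-isEquivalence }

  open Setoid ≋-setoid using () renaming (refl to ≋-refl; trans to ≋-trans)
  module ≋-Reasoning = SetoidReasoning ≋-setoid

  ∷-cong : ∀ {a b A B} → a ≈ b → A ≋ B → a ∷ A ≋ b ∷ B
  ∷-cong a≈b A≋B .coeff-≈ zero    = a≈b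
  ∷-cong a≈b A≋B .coeff-≈ (suc r) = coeff-≈ A≋B r

  ⊗-cong : ∀ {A A′ B B′} → A ≋ A′ → B ≋ B′ → A ⊗ B ≋ A′ ⊗ B′
  ⊗-cong {A} {A′} {B} {B′} A≋A′ B≋B′ .coeff-≈ r = begin
    coeff (A ⊗ B) r                        ≈⟨ coeff-⊗ A B r ⟩
    convolve (coeff A) (coeff B) r         ≈⟨ convolve-cong (coeff-≈ A≋A′) (coeff-≈ B≋B′) r ⟩
    convolve (coeff A′) (coeff B′) r       ≈⟨ coeff-⊗ A′ B′ r ⟨
    coeff (A′ ⊗ B′) r                      ∎
    where open ≈-Reasoning

  ⊗-congˡ : ∀ A {B B′} → B ≋ B′ → A ⊗ B ≋ A ⊗ B′
  ⊗-congˡ A = ⊗-cong (≋-refl {A})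

  polyPow-cong : ∀ {F G} → F ≋ G → ∀ n → polyPow F n ≋ polyPow G n
  polyPow-cong F≋G zero    = ≋-refl
  polyPow-cong F≋G (suc n) = ⊗-cong F≋G (polyPow-cong F≋G n)

  ⊗-identityˡ : ∀ B → (1# ∷ []) ⊗ B ≋ B
  ⊗-identityˡ B .coeff-≈ r = trans (coeff-⊗ (1# ∷ []) B r) (convolve-one r)
    where
    convolve-one : ∀ r → convolve (coeff (1# ∷ [])) (coeff B) r ≈ coeff B r
    convolve-one zero    = *-identityˡ _
    convolve-one (suc r) =
      trans (+-cong (*-identityˡ _) (convolve-zeroˡ (coeff B) (λ _ → refl) r)) (+-identityʳ _)

  0∷-⊗ : ∀ A B → (0# ∷ A) ⊗ B ≋ 0# ∷ A ⊗ B
  0∷-⊗ A B .coeff-≈ r =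
    trans (coeff-⊕ (map (0# ·_) B) _ r)
          (trans (+-congʳ (trans (coeff-map-· 0# B r) (zeroˡ _))) (+-identityˡ _))

  ⊗-0∷ : ∀ A B → A ⊗ (0# ∷ B) ≋ 0# ∷ A ⊗ B
  ⊗-0∷ A B .coeff-≈ zero    = trans (coeff-⊗ A (0# ∷ B) 0) (zeroʳ _)
  ⊗-0∷ A B .coeff-≈ (suc r) =
    trans (coeff-⊗ A (0# ∷ B) (suc r)) (trans (convolve-0∷ʳ (coeff A) B r) (sym (coeff-⊗ A B r)))

  shift : ℕ → Poly → Poly
  shift zero    A = A
  shift (suc s) A = 0# ∷ shift s A

  shift-cong : ∀ s {A B} → A ≋ B → shift s A ≋ shift s B
  shift-cong zero    A≋B = A≋B
  shift-cong (suc s) A≋B = ∷-cong refl (shift-cong s A≋B)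

  shift-+ : ∀ s t A → shift (s ℕ.+ t) A ≡ shift s (shift t A)
  shift-+ zero    t A = ≡.refl
  shift-+ (suc s) t A = cong (0# ∷_) (shift-+ s t A)

  coeff-shift-+ : ∀ s A r → coeff (shift s A) (s ℕ.+ r) ≡ coeff A r
  coeff-shift-+ zero    A r = ≡.refl
  coeff-shift-+ (suc s) A r = coeff-shift-+ s A r

  coeff-shift-< : ∀ s A {r} → r < s → coeff (shift s A) r ≡ 0#
  coeff-shift-< (suc s) A {zero}  _             = ≡.refl
  coeff-shift-< (suc s) A {suc r} (ℕ.s≤s r<s) = coeff-shift-< s A r<s

  shift-⊗ : ∀ s A B → shift s A ⊗ B ≋ shift s (A ⊗ B)
  shift-⊗ zero    A B = ≋-refl
  shift-⊗ (suc s) A B = ≋-trans (0∷-⊗ (shift s A) B) (∷-cong refl (shift-⊗ s A B))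

  ⊗-shift : ∀ s A B → A ⊗ shift s B ≋ shift s (A ⊗ B)
  ⊗-shift zero    A B = ≋-refl
  ⊗-shift (suc s) A B = ≋-trans (⊗-0∷ A (shift s B)) (∷-cong refl (⊗-shift s A B))

  polyPow-shift : ∀ s H n → polyPow (shift s H) n ≋ shift (n * s) (polyPow H n)
  polyPow-shift s H zero    = ≋-refl
  polyPow-shift s H (suc n) = begin
    shift s H ⊗ polyPow (shift s H) n  ≈⟨ ⊗-congˡ (shift s H) (polyPow-shift s H n) ⟩
    shift s H ⊗ shift (n * s) P        ≈⟨ shift-⊗ s H _ ⟩
    shift s (H ⊗ shift (n * s) P)      ≈⟨ shift-cong s (⊗-shift (n * s) H P) ⟩
    shift s (shift (n * s) (H ⊗ P))    ≡⟨ shift-+ s (n * s) (H ⊗ P) ⟨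
    shift (s ℕ.+ n * s) (H ⊗ P)        ∎
    where
    open ≋-Reasoning
    P : Poly
    P = polyPow H n

  prodLin-++-replicate : ∀ Ls s → prodLin (Ls ++ replicate s 0#) ≋ shift s (prodLin Ls)
  prodLin-++-replicate []       zero    = ≋-refl
  prodLin-++-replicate []       (suc s) = begin
    ((- 0#) ∷ 1# ∷ []) ⊗ prodLin (replicate s 0#)
      ≈⟨ ⊗-cong (∷-cong -0#≈0# (≋-refl {1# ∷ []})) (prodLin-++-replicate [] s) ⟩
    (0# ∷ 1# ∷ []) ⊗ shift s (1# ∷ [])  ≈⟨ 0∷-⊗ (1# ∷ []) _ ⟩
    0# ∷ (1# ∷ []) ⊗ shift s (1# ∷ [])  ≈⟨ ∷-cong refl (⊗-identityˡ _) ⟩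
    0# ∷ shift s (1# ∷ [])              ∎
    where open ≋-Reasoning
  prodLin-++-replicate (a ∷ Ls) s       =
    ≋-trans (⊗-congˡ ((- a) ∷ 1# ∷ []) (prodLin-++-replicate Ls s))
            (⊗-shift s ((- a) ∷ 1# ∷ []) (prodLin Ls))

  polyPow-prodLin-++-replicate : ∀ Ls s n →
    polyPow (prodLin (Ls ++ replicate s 0#)) n ≋ shift (n * s) (polyPow (prodLin Ls) n)
  polyPow-prodLin-++-replicate Ls s n =
    ≋-trans (polyPow-cong (prodLin-++-replicate Ls s) n) (polyPow-shift s (prodLin Ls) n)

  pow-cong : ∀ {x y} n → x ≈ y → pow R x n ≈ pow R y n
  pow-cong zero    x≈y = refl
  pow-cong (suc n) x≈y = *-cong x≈y (pow-cong n x≈y)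

  coeff-polyPow-0 : ∀ F n → coeff (polyPow F n) 0 ≈ pow R (coeff F 0) n
  coeff-polyPow-0 F zero    = refl
  coeff-polyPow-0 F (suc n) = trans (coeff-⊗ F (polyPow F n) 0) (*-congˡ (coeff-polyPow-0 F n))

  coeff-prodLin-0 : ∀ Ls → coeff (prodLin Ls) 0 ≈ prodL R (map -_ Ls)
  coeff-prodLin-0 []       = refl
  coeff-prodLin-0 (a ∷ Ls) =
    trans (coeff-⊗ ((- a) ∷ 1# ∷ []) (prodLin Ls) 0) (*-congˡ (coeff-prodLin-0 Ls))

  -x·-y≈x·y : ∀ x y → - x · - y ≈ x · y
  -x·-y≈x·y x y = begin
    - x · - y      ≈⟨ -‿distribʳ-* (- x) y ⟨
    - (- x · y)    ≈⟨ -‿cong (-‿distribˡ-* x y) ⟨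
    - (- (x · y))  ≈⟨ -‿involutive _ ⟩
    x · y          ∎
    where open ≈-Reasoning

  prodL-map-neg-even : ∀ k Ls → length Ls ≡ k * 2 → prodL R (map -_ Ls) ≈ prodL R Ls
  prodL-map-neg-even zero    []           _   = refl
  prodL-map-neg-even (suc k) (a ∷ b ∷ Ls) len = begin
    - a · (- b · prodL R (map -_ Ls))  ≈⟨ *-assoc _ _ _ ⟨
    (- a · - b) · prodL R (map -_ Ls)  ≈⟨ *-cong (-x·-y≈x·y a b) (prodL-map-neg-even k Ls len′) ⟩
    (a · b) · prodL R Ls               ≈⟨ *-assoc _ _ _ ⟩
    a · (b · prodL R Ls)               ∎
    where
    open ≈-Reasoning
    len′ : length Ls ≡ k * 2
    len′ = suc-injective (suc-injective len)

  prodL-map-neg-odd : ∀ k Ls → length Ls ≡ suc (k * 2) → prodL R (map -_ Ls) ≈ - prodL R Ls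
  prodL-map-neg-odd k (a ∷ Ls) len =
    trans (*-congˡ (prodL-map-neg-even k Ls (suc-injective len))) (sym (-‿distribˡ-* a (prodL R Ls)))

  coeff-polyPow-prodLin-0 : ∀ k Ls → length Ls ≡ suc (k * 2) →
    ∀ n → coeff (polyPow (prodLin Ls) n) 0 ≈ pow R (- prodL R Ls) n
  coeff-polyPow-prodLin-0 k Ls len n =
    trans (coeff-polyPow-0 (prodLin Ls) n)
          (pow-cong n (trans (coeff-prodLin-0 Ls) (prodL-map-neg-odd k Ls len)))

  sumFin-cong : ∀ n {f g} → (∀ i → f i ≈ g i) → sumFin n f ≈ sumFin n g
  sumFin-cong zero    f≈g = refl
  sumFin-cong (suc n) f≈g = +-cong (f≈g Fin.zero) (sumFin-cong n (f≈g ∘ Fin.suc))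

  sumFin-zero : ∀ n {f} → (∀ i → f i ≈ 0#) → sumFin n f ≈ 0#
  sumFin-zero zero    f≈0 = refl
  sumFin-zero (suc n) f≈0 =
    trans (+-cong (f≈0 Fin.zero) (sumFin-zero n (f≈0 ∘ Fin.suc))) (+-identityˡ 0#)

  laplaceTerm : ∀ n → (Fin (suc n) → Fin (suc n) → Carrier) → Fin (suc n) → Carrier
  laplaceTerm n M j =
    pow R (- 1#) (toℕ j) · (M Fin.zero j · det n (λ a b → M (Fin.suc a) (Fin.punchIn j b)))

  det-cong : ∀ n {M N} → (∀ i j → M i j ≈ N i j) → det n M ≈ det n N
  det-cong zero    M≈N = refl
  det-cong (suc n) {M} {N} M≈N = sumFin-cong (suc n) {laplaceTerm n M} {laplaceTerm n N} λ j →
    *-congˡ (*-cong (M≈N Fin.zero j) (det-cong n λ a b → M≈N (Fin.suc a) (Fin.punchIn j b)))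

  det-sparseFirstRow : ∀ n (M : Fin (suc n) → Fin (suc n) → Carrier) →
    (∀ j → M Fin.zero (Fin.suc j) ≈ 0#) →
    det (suc n) M ≈ M Fin.zero Fin.zero · det n (λ i j → M (Fin.suc i) (Fin.suc j))
  det-sparseFirstRow n M row≈0 =
    trans (+-cong (*-identityˡ _) (sumFin-zero n later≈0)) (+-identityʳ _)
    where
    later≈0 : ∀ j → laplaceTerm n M (Fin.suc j) ≈ 0#
    later≈0 j = trans (*-congˡ (trans (*-congʳ (row≈0 j)) (zeroˡ _))) (zeroʳ _)

  coeff∸ : Poly → ℕ → ℕ → Carrier
  coeff∸ P m j = if j ≤ᵇ m then coeff P (m ∸ j) else 0#

  -- Defs.matA p h λs is cartierManin (polyPow (prodLin λs) ⌊ p ∸ 1 /2⌋) p h by definition.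
  cartierManin : Poly → (p h : ℕ) → Fin h → Fin h → Carrier
  cartierManin P p h i j = coeff∸ P (suc (toℕ i) * p) (suc (toℕ j))

  coeff∸-≤ : ∀ P {m j} → j ≤ m → coeff∸ P m j ≡ coeff P (m ∸ j)
  coeff∸-≤ P {m} {j} j≤m with j ≤ᵇ m | ≤ᵇ-reflects-≤ j m
  ... | true  | _       = ≡.refl
  ... | false | ofⁿ j≰m = contradiction j≤m j≰m

  coeff∸-> : ∀ P {m j} → m < j → coeff∸ P m j ≡ 0#
  coeff∸-> P {m} {j} m<j with j ≤ᵇ m | ≤ᵇ-reflects-≤ j m
  ... | true  | ofʸ j≤m = contradiction j≤m (<⇒≱ m<j)
  ... | false | _       = ≡.refl

  coeff∸-suc : ∀ P m j → coeff∸ P (suc m) (suc j) ≡ coeff∸ P m j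
  coeff∸-suc P m zero    = ≡.refl
  coeff∸-suc P m (suc j) = ≡.refl

  coeff∸-shift : ∀ q {F H} → F ≋ shift q H → ∀ m j → coeff∸ F (q ℕ.+ m) j ≈ coeff∸ H m j
  coeff∸-shift q {F} {H} F≋ m j with j ≤? m
  ... | yes j≤m = begin
    coeff∸ F (q ℕ.+ m) j               ≡⟨ coeff∸-≤ F (≤-trans j≤m (m≤n+m m q)) ⟩
    coeff F (q ℕ.+ m ∸ j)              ≡⟨ cong (coeff F) (+-∸-assoc q j≤m) ⟩
    coeff F (q ℕ.+ (m ∸ j))            ≈⟨ coeff-≈ F≋ _ ⟩
    coeff (shift q H) (q ℕ.+ (m ∸ j))  ≡⟨ coeff-shift-+ q H (m ∸ j) ⟩
    coeff H (m ∸ j)                    ≡⟨ coeff∸-≤ H j≤m ⟨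
    coeff∸ H m j                       ∎
    where open ≈-Reasoning
  ... | no j≰m = trans below-q (reflexive (≡.sym (coeff∸-> H (≰⇒> j≰m))))
    where
    below-q : coeff∸ F (q ℕ.+ m) j ≈ 0#
    below-q with j ≤? q ℕ.+ m
    ... | no j≰q+m  = reflexive (coeff∸-> F (≰⇒> j≰q+m))
    ... | yes j≤q+m = begin
      coeff∸ F (q ℕ.+ m) j             ≡⟨ coeff∸-≤ F j≤q+m ⟩
      coeff F (q ℕ.+ m ∸ j)            ≈⟨ coeff-≈ F≋ _ ⟩
      coeff (shift q H) (q ℕ.+ m ∸ j)  ≡⟨ coeff-shift-< q H q+m∸j<q ⟩
      0#                               ∎
      where
      open ≈-Reasoning
      q+m∸j<q : q ℕ.+ m ∸ j < q
      q+m∸j<q = subst (q ℕ.+ m ∸ j <_) (m+n∸n≡m q m) (∸-monoʳ-< (≰⇒> j≰m) j≤q+m)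

  cartierManin-shift : ∀ q h {F H} → F ≋ shift q H →
    det (suc h) (cartierManin F (suc q) (suc h)) ≈ coeff H 0 · det h (cartierManin H (suc q) h)
  cartierManin-shift q h {F} {H} F≋ =
    trans (det-sparseFirstRow h (cartierManin F (suc q) (suc h)) (λ j → shifted 0 (suc (toℕ j))))
          (*-cong (shifted 0 0) (det-cong h {N = cartierManin H (suc q) h} λ i j →
            shifted (suc (toℕ i) * suc q) (suc (toℕ j))))
    where
    shifted : ∀ m j → coeff∸ F (suc (q ℕ.+ m)) (suc j) ≈ coeff∸ H m j
    shifted m j = trans (reflexive (coeff∸-suc F (q ℕ.+ m) j)) (coeff∸-shift q F≋ m j)

  Det-++-zero-zero : ∀ q → ⌊ q /2⌋ * 2 ≡ q → ∀ h k Ls → length Ls ≡ suc (k * 2) →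
    Det R (suc q) (suc h) (Ls ++ 0# ∷ 0# ∷ []) ≈ pow R (- prodL R Ls) ⌊ q /2⌋ · Det R (suc q) h Ls
  Det-++-zero-zero q q-even h k Ls len = begin
    Det R (suc q) (suc h) (Ls ++ replicate 2 0#)  ≈⟨ cartierManin-shift q h F≋ ⟩
    coeff H 0 · Det R (suc q) h Ls                ≈⟨ *-congʳ (coeff-polyPow-prodLin-0 k Ls len n) ⟩
    pow R (- prodL R Ls) n · Det R (suc q) h Ls   ∎
    where
    open ≈-Reasoning
    n : ℕ
    n = ⌊ q /2⌋
    H : Poly
    H = polyPow (prodLin Ls) n
    F≋ : polyPow (prodLin (Ls ++ replicate 2 0#)) n ≋ shift q H
    F≋ = subst (λ s → polyPow (prodLin (Ls ++ replicate 2 0#)) n ≋ shift s H) q-even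
               (polyPow-prodLin-++-replicate Ls 2 n)

⌊n/2⌋*2≡n⊎1+⌊n/2⌋*2≡n : ∀ n → ⌊ n /2⌋ * 2 ≡ n ⊎ suc (⌊ n /2⌋ * 2) ≡ n
⌊n/2⌋*2≡n⊎1+⌊n/2⌋*2≡n zero          = inj₁ ≡.refl
⌊n/2⌋*2≡n⊎1+⌊n/2⌋*2≡n (suc zero)    = inj₂ ≡.refl
⌊n/2⌋*2≡n⊎1+⌊n/2⌋*2≡n (suc (suc n)) =
  Sum.map (cong (suc ∘ suc)) (cong (suc ∘ suc)) (⌊n/2⌋*2≡n⊎1+⌊n/2⌋*2≡n n)

prime>2⇒⌊p∸1/2⌋*2≡p∸1 : ∀ {q} → Prime (suc q) → 2 < suc q → ⌊ q /2⌋ * 2 ≡ q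
prime>2⇒⌊p∸1/2⌋*2≡p∸1 {q} p-prime 2<p with ⌊n/2⌋*2≡n⊎1+⌊n/2⌋*2≡n q
... | inj₁ q-even = q-even
... | inj₂ q-odd  = contradiction (composite-≢ 2 (<⇒≢ 2<p) 2∣p) (prime⇒¬composite p-prime)
  where
  2∣p : 2 ∣ suc q
  2∣p = divides (suc ⌊ q /2⌋) (cong suc (≡.sym q-odd))

lemma4p4 : ∀ {c ℓ c′ ℓ′}
    (k : CommutativeRing c ℓ) → IsField k →
    (p : ℕ) → Prime p → 2 < p →
    CommutativeRing._≈_ k (ofℕ k p) (CommutativeRing.0# k) →
    (R : CommutativeRing c′ ℓ′) →
    (f : CommutativeRing.Carrier k → CommutativeRing.Carrier R) →
    RingMorphisms.IsRingHomomorphism (CommutativeRing.rawRing k) (CommutativeRing.rawRing R) f →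
    (g : ℕ) → 2 ≤ g →
    (λs : Vec (CommutativeRing.Carrier R) (2 * g ∸ 1)) →
    CommutativeRing._≈_ R
      (Det R p g (toList λs ++ CommutativeRing.0# R ∷ CommutativeRing.0# R ∷ []))
      (CommutativeRing._*_ R
        (pow R (CommutativeRing.-_ R (prodL R (toList λs))) ⌊ p ∸ 1 /2⌋)
        (Det R p (g ∸ 1) (toList λs)))
lemma4p4 k _ (suc q) p-prime 2<p _ R _ _ (suc h) _ λs =
  Det-++-zero-zero R q (prime>2⇒⌊p∸1/2⌋*2≡p∸1 p-prime 2<p) h h (toList λs) odd-length
  where
  odd-length : length (toList λs) ≡ suc (h * 2)
  odd-length = ≡.trans (length-toList λs) (≡.trans (+-suc h (h ℕ.+ 0)) (cong suc (*-comm 2 h)))
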